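{- Let $G$ be a clique tree in which every block is a clique with at least $3$ vertices. Let $v$ be a cut vertex of $G$ and let $K_m$ be a pendant block of $G$ containing $v$. Let $G_1 = G - (V(K_m)\setminus\{v\})$, so that $G = G_1 \oplus_v K_m$. Then $$Z(G_1\oplus_v K_m) = Z(G_1) + Z(K_m) - 1.$$
   Context: A block is a maximal connected subgraph without a cut vertex; a clique tree is a connected graph each of whose blocks is complete. A pendant block is a block containing exactly one cut vertex of $G$. If $G-v$ has two parts $W_1,W_2$ and $G_i$ is the subgraph induced by $\{v\}\cup V(W_i)$, then $G=G_1\oplus_v G_2$ (vertex-sum at $v$). $Z(\cdot)$ is the zero forcing number: the minimum size of a set $S$ of initially blue vertices such that repeatedly applying the rule "a blue vertex with exactly one white neighbor turns that neighbor blue" makes all vertices blue. -}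

module Defs where

open import Data.Nat using (ℕ; _≤_; _∸_; _+_)
open import Data.Fin using (Fin)
open import Data.Fin.Subset using (Subset; _∈_; _∉_; _⊆_; _∪_; _─_; _-_; ⁅_⁆; ∣_∣; ⊤)
open import Data.Product using (Σ; _×_; ∃)
open import Relation.Binary.PropositionalEquality using (_≡_)
open import Relation.Nullary using (¬_; Dec)

record SimpleGraph (n : ℕ) : Set₁ where
  field
    Adj     : Fin n → Fin n → Set
    adj?    : ∀ x y → Dec (Adj x y)
    sym     : ∀ {x y} → Adj x y → Adj y x
    irrefl  : ∀ {x} → ¬ Adj x x
open SimpleGraph public

module _ {n : ℕ} (G : SimpleGraph n) where

  -- Throughout, a vertex subset U stands for the induced subgraph G[U].

  data WalkIn (U : Subset n) : Fin n → Fin n → Set where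
    here : ∀ {x} → x ∈ U → WalkIn U x x
    step : ∀ {x y z} → x ∈ U → Adj G x y → WalkIn U y z → WalkIn U x z

  Connected : Subset n → Set
  Connected U = ∀ {x y} → x ∈ U → y ∈ U → WalkIn U x y

  IsCutVertexIn : Subset n → Fin n → Set
  IsCutVertexIn U v = v ∈ U × ¬ Connected (U - v)

  IsCutVertex : Fin n → Set
  IsCutVertex v = IsCutVertexIn ⊤ v

  Nonseparable : Subset n → Set
  Nonseparable B = Connected B × (∀ v → ¬ IsCutVertexIn B v)

  -- A block: a maximal connected subgraph without a cut vertex
  -- (maximal subgraphs of this kind are induced, so vertex sets suffice).
  IsBlock : Subset n → Set
  IsBlock B = Nonseparable B × (∀ B′ → B ⊆ B′ → Nonseparable B′ → B′ ⊆ B)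

  IsClique : Subset n → Set
  IsClique B = ∀ {x y} → x ∈ B → y ∈ B → ¬ x ≡ y → Adj G x y

  IsCliqueTree : Set
  IsCliqueTree = Connected ⊤ × (∀ B → IsBlock B → IsClique B)

  IsPendantBlock : Subset n → Set
  IsPendantBlock B = IsBlock B × Σ (Fin n) λ c →
    (c ∈ B × IsCutVertex c) × (∀ u → u ∈ B → IsCutVertex u → u ≡ c)

  Forces : Subset n → Subset n → Fin n → Fin n → Set
  Forces U Blue u w =
    u ∈ U × u ∈ Blue × w ∈ U × w ∉ Blue × Adj G u w ×
    (∀ x → x ∈ U → Adj G u x → x ∉ Blue → x ≡ w)

  data Reach (U : Subset n) (S : Subset n) : Subset n → Set where
    start : Reach U S S
    force : ∀ {Blue u w} → Reach U S Blue → Forces U Blue u w →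
            Reach U S (Blue ∪ ⁅ w ⁆)

  IsZFS : Subset n → Subset n → Set
  IsZFS U S = S ⊆ U × ∃ λ Blue → Reach U S Blue × U ⊆ Blue

  ZeroForcingNumber : Subset n → ℕ → Set
  ZeroForcingNumber U k =
    (∃ λ S → IsZFS U S × ∣ S ∣ ≡ k) × (∀ S → IsZFS U S → k ≤ ∣ S ∣)

{-# OPTIONS --safe #-}
-- Write K′ = K − v and A = V(G) − K′, so that G[A] = G₁. A vertex of a complete block with a
-- neighbour outside the block is a cut vertex, so every vertex of K′ is adjacent exactly to the
-- rest of K: the vertices of K′ are closed twins, and G[A] meets K′ only through v.
-- A zero forcing set misses at most one of a set of closed twins; this gives Z(K) = |K| − 1,
-- and shows that a zero forcing set T of G either contains K′, and then (T ∩ A) ∪ {v} forces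
-- G[A], or misses exactly one w′ ∈ K′, and then T ∩ A already forces G[A] because no vertex of
-- K′ can force v before w′ is blue. Conversely a zero forcing set of G₁ together with K′ − w
-- forces G: the forces of G₁ are replayed, and once v is blue a third vertex x ∈ K′ − w forces w
-- (this is where |K| ≥ 3 is needed).
module Submission where

open import Defs renaming (sym to Adj-sym)
open import Data.Nat using (ℕ; zero; suc; _≤_; _∸_; _+_; z≤n; s≤s; s≤s⁻¹)
open import Data.Nat.Properties
  using (≤-refl; ≤-trans; ≤-antisym; n≤1+n; +-suc; +-mono-≤; module ≤-Reasoning)
open import Data.Fin using (Fin; zero; suc)
open import Data.Fin.Properties using (_≟_)
open import Data.Fin.Subset
  using (Subset; _∈_; _∉_; _⊆_; _∪_; _∩_; _─_; _-_; ⁅_⁆; ∣_∣; ⊤; ⋃; Nonempty; inside; outside)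
open import Data.Fin.Subset.Properties
  using (_∈?_; ∈⊤; ∉⊥; x∈⁅x⁆; x∈⁅y⁆⇒x≡y; x∉⁅y⁆⇒x≢y; x∈p∪q⁺; x∈p∪q⁻; x∈p∩q⁺; x∈p∩q⁻;
         x∈p∧x∉q⇒x∈p─q; x∈p∧x≢y⇒x∈p-y; p─⊥≡p; p⊆q⇒∣p∣≤∣q∣; p⊆p∪q; ∣p∩q∣≤∣p∣)
open import Data.Vec using ([]; _∷_; here; there)
open import Data.List using (List; []; _∷_; map)
open import Data.List.Relation.Unary.All using (All; []; _∷_; lookup; tabulate)
open import Data.List.Relation.Unary.Any using (here; there)
open import Data.Product using (_×_; ∃; _,_; proj₁; proj₂)
open import Data.Sum using (_⊎_; inj₁; inj₂; [_,_]′; map₁)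
open import Data.Empty using (⊥-elim)
open import Function using (_∘_; id; const)
open import Relation.Binary.PropositionalEquality
  using (_≡_; _≢_; refl; sym; trans; cong; subst)
open import Relation.Nullary using (¬_; yes; no)

private
  variable
    n : ℕ

x∈p─q⁻ : ∀ (p q : Subset n) {x} → x ∈ p ─ q → x ∈ p × x ∉ q
x∈p─q⁻ (s ∷ p) (outside ∷ q) {zero} here = here , λ ()
x∈p─q⁻ (s ∷ p) (inside ∷ q) {zero} ()
x∈p─q⁻ (s ∷ p) (t ∷ q) {suc x} (there m) with x∈p─q⁻ p q m
... | x∈p , x∉q = there x∈p , λ { (there x∈q) → x∉q x∈q }

x∈p-y⁻ : ∀ (p : Subset n) {x y} → x ∈ p - y → x ∈ p × x ≢ y
x∈p-y⁻ p {y = y} m with x∈p─q⁻ p ⁅ y ⁆ m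
... | x∈p , x∉⁅y⁆ = x∈p , x∉⁅y⁆⇒x≢y x∉⁅y⁆

x∈p∪⁅y⁆⁻ : ∀ (p : Subset n) {x y} → x ∈ p ∪ ⁅ y ⁆ → x ∈ p ⊎ x ≡ y
x∈p∪⁅y⁆⁻ p {y = y} m with x∈p∪q⁻ p ⁅ y ⁆ m
... | inj₁ x∈p = inj₁ x∈p
... | inj₂ x∈⁅y⁆ = inj₂ (x∈⁅y⁆⇒x≡y y x∈⁅y⁆)

x∈p∪⁅y⁆⁺ : ∀ {p : Subset n} {x y} → x ∈ p ⊎ x ≡ y → x ∈ p ∪ ⁅ y ⁆
x∈p∪⁅y⁆⁺ (inj₁ x∈p) = x∈p∪q⁺ (inj₁ x∈p)
x∈p∪⁅y⁆⁺ {x = x} (inj₂ refl) = x∈p∪q⁺ (inj₂ (x∈⁅x⁆ x))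

p⊆p-x∪⁅x⁆ : ∀ (p : Subset n) x → p ⊆ (p - x) ∪ ⁅ x ⁆
p⊆p-x∪⁅x⁆ p x {y} y∈p with y ≟ x
... | yes y≡x = x∈p∪⁅y⁆⁺ (inj₂ y≡x)
... | no y≢x = x∈p∪⁅y⁆⁺ (inj₁ (x∈p∧x≢y⇒x∈p-y y∈p y≢x))

∣p∣≡1+∣p-x∣ : ∀ (p : Subset n) {x} → x ∈ p → ∣ p ∣ ≡ suc ∣ p - x ∣
∣p∣≡1+∣p-x∣ (inside ∷ p) {zero} here = cong (suc ∘ ∣_∣) (sym (p─⊥≡p p))
∣p∣≡1+∣p-x∣ (inside ∷ p) {suc x} (there m) = cong suc (∣p∣≡1+∣p-x∣ p m)
∣p∣≡1+∣p-x∣ (outside ∷ p) {suc x} (there m) = ∣p∣≡1+∣p-x∣ p m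

disjoint⇒∣p∪q∣≡∣p∣+∣q∣ : ∀ (p q : Subset n) → (∀ {x} → x ∈ p → x ∉ q) →
                         ∣ p ∪ q ∣ ≡ ∣ p ∣ + ∣ q ∣
disjoint⇒∣p∪q∣≡∣p∣+∣q∣ [] [] _ = refl
disjoint⇒∣p∪q∣≡∣p∣+∣q∣ (inside ∷ p) (inside ∷ q) disj = ⊥-elim (disj here here)
disjoint⇒∣p∪q∣≡∣p∣+∣q∣ (inside ∷ p) (outside ∷ q) disj =
  cong suc (disjoint⇒∣p∪q∣≡∣p∣+∣q∣ p q (λ x∈p x∈q → disj (there x∈p) (there x∈q)))
disjoint⇒∣p∪q∣≡∣p∣+∣q∣ (outside ∷ p) (inside ∷ q) disj =
  trans (cong suc (disjoint⇒∣p∪q∣≡∣p∣+∣q∣ p q (λ x∈p x∈q → disj (there x∈p) (there x∈q))))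
        (sym (+-suc ∣ p ∣ ∣ q ∣))
disjoint⇒∣p∪q∣≡∣p∣+∣q∣ (outside ∷ p) (outside ∷ q) disj =
  disjoint⇒∣p∪q∣≡∣p∣+∣q∣ p q (λ x∈p x∈q → disj (there x∈p) (there x∈q))

⊆⊎∃∉ : ∀ (p q : Subset n) → p ⊆ q ⊎ ∃ λ x → x ∈ p × x ∉ q
⊆⊎∃∉ [] [] = inj₁ λ ()
⊆⊎∃∉ (inside ∷ p) (outside ∷ q) = inj₂ (zero , here , λ ())
⊆⊎∃∉ (s ∷ p) (t ∷ q) with ⊆⊎∃∉ p q
... | inj₂ (x , x∈p , x∉q) = inj₂ (suc x , there x∈p , λ { (there x∈q) → x∉q x∈q })
⊆⊎∃∉ (outside ∷ p) (t ∷ q) | inj₁ p⊆q = inj₁ λ { (there x∈p) → there (p⊆q x∈p) }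
⊆⊎∃∉ (inside ∷ p) (outside ∷ q) | inj₁ _ = inj₂ (zero , here , λ ())
⊆⊎∃∉ (inside ∷ p) (inside ∷ q) | inj₁ p⊆q = inj₁ λ { here → here ; (there x∈p) → there (p⊆q x∈p) }

∣p∣≤1+∣q∣ : ∀ (p q : Subset n) → (∀ {x y} → x ∈ p → y ∈ p → x ∉ q → y ∉ q → x ≡ y) →
            ∣ p ∣ ≤ suc ∣ q ∣
∣p∣≤1+∣q∣ p q atMostOne with ⊆⊎∃∉ p q
... | inj₁ p⊆q = ≤-trans (p⊆q⇒∣p∣≤∣q∣ p⊆q) (n≤1+n ∣ q ∣)
... | inj₂ (x , x∈p , x∉q) = subst (_≤ suc ∣ q ∣) (sym (∣p∣≡1+∣p-x∣ p x∈p)) (s≤s (p⊆q⇒∣p∣≤∣q∣ p-x⊆q))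
  where
  p-x⊆q : p - x ⊆ q
  p-x⊆q {y} y∈p-x with x∈p-y⁻ p y∈p-x | y ∈? q
  ... | _ , _ | yes y∈q = y∈q
  ... | y∈p , y≢x | no y∉q = ⊥-elim (y≢x (atMostOne y∈p x∈p y∉q x∉q))

∣p∪⁅x⁆∣≤1+∣p∣ : ∀ (p : Subset n) x → ∣ p ∪ ⁅ x ⁆ ∣ ≤ suc ∣ p ∣
∣p∪⁅x⁆∣≤1+∣p∣ p x = ∣p∣≤1+∣q∣ (p ∪ ⁅ x ⁆) p λ y∈ z∈ y∉p z∉p →
  trans (only-x y∈ y∉p) (sym (only-x z∈ z∉p))
  where
  only-x : ∀ {y} → y ∈ p ∪ ⁅ x ⁆ → y ∉ p → y ≡ x
  only-x y∈ y∉p = [ ⊥-elim ∘ y∉p , id ]′ (x∈p∪⁅y⁆⁻ p y∈)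

disjoint⇒∣p∩q∣+∣p∩r∣≤∣p∣ : ∀ (p q r : Subset n) → (∀ {x} → x ∈ q → x ∉ r) → ∣ p ∩ q ∣ + ∣ p ∩ r ∣ ≤ ∣ p ∣
disjoint⇒∣p∩q∣+∣p∩r∣≤∣p∣ p q r disj = begin
  ∣ p ∩ q ∣ + ∣ p ∩ r ∣  ≡⟨ sym (disjoint⇒∣p∪q∣≡∣p∣+∣q∣ (p ∩ q) (p ∩ r) λ x∈p∩q x∈p∩r →
                              disj (proj₂ (x∈p∩q⁻ p q x∈p∩q)) (proj₂ (x∈p∩q⁻ p r x∈p∩r))) ⟩
  ∣ (p ∩ q) ∪ (p ∩ r) ∣  ≤⟨ p⊆q⇒∣p∣≤∣q∣ ([ proj₁ ∘ x∈p∩q⁻ p q , proj₁ ∘ x∈p∩q⁻ p r ]′ ∘ x∈p∪q⁻ (p ∩ q) (p ∩ r)) ⟩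
  ∣ p ∣                  ∎
  where open ≤-Reasoning

1≤∣p∣⇒Nonempty : ∀ (p : Subset n) → 1 ≤ ∣ p ∣ → Nonempty p
1≤∣p∣⇒Nonempty (inside ∷ p) _ = zero , here
1≤∣p∣⇒Nonempty (outside ∷ p) 1≤∣p∣ with 1≤∣p∣⇒Nonempty p 1≤∣p∣
... | x , x∈p = suc x , there x∈p

3≤∣p∣⇒two-others : ∀ (p : Subset n) {x} → x ∈ p → 3 ≤ ∣ p ∣ →
                   ∃ λ y → y ∈ p - x × Nonempty (p - x - y)
3≤∣p∣⇒two-others p {x} x∈p 3≤∣p∣ with subst (3 ≤_) (∣p∣≡1+∣p-x∣ p x∈p) 3≤∣p∣
... | s≤s 2≤∣p-x∣ with 1≤∣p∣⇒Nonempty (p - x) (≤-trans (s≤s z≤n) 2≤∣p-x∣)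
... | y , y∈p-x with subst (2 ≤_) (∣p∣≡1+∣p-x∣ (p - x) y∈p-x) 2≤∣p-x∣
... | s≤s 1≤∣p-x-y∣ = y , y∈p-x , 1≤∣p∣⇒Nonempty (p - x - y) 1≤∣p-x-y∣

module _ {n : ℕ} (G : SimpleGraph n) where

  walk-source∈ : ∀ {U a b} → WalkIn G U a b → a ∈ U
  walk-source∈ (here a∈U) = a∈U
  walk-source∈ (step a∈U _ _) = a∈U

  walk-target∈ : ∀ {U a b} → WalkIn G U a b → b ∈ U
  walk-target∈ (here b∈U) = b∈U
  walk-target∈ (step _ _ walk) = walk-target∈ walk

  walk-++ : ∀ {U a b c} → WalkIn G U a b → WalkIn G U b c → WalkIn G U a c
  walk-++ (here _) walk′ = walk′
  walk-++ (step a∈U e walk) walk′ = step a∈U e (walk-++ walk walk′)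

  walk-snoc : ∀ {U a b c} → WalkIn G U a b → Adj G b c → c ∈ U → WalkIn G U a c
  walk-snoc walk e c∈U = walk-++ walk (step (walk-target∈ walk) e (here c∈U))

  walk-reverse : ∀ {U a b} → WalkIn G U a b → WalkIn G U b a
  walk-reverse (here a∈U) = here a∈U
  walk-reverse (step a∈U e walk) = walk-snoc (walk-reverse walk) (Adj-sym G e) a∈U

  connected-via-clique : ∀ {K W} → IsClique G K →
                         (∀ {a} → a ∈ W → ∃ λ k → k ∈ K × WalkIn G W a k) → Connected G W
  connected-via-clique clique toK a∈W b∈W with toK a∈W | toK b∈W
  ... | k , k∈K , a⇝k | l , l∈K , b⇝l with k ≟ l
  ... | yes refl = walk-++ a⇝k (walk-reverse b⇝l)
  ... | no k≢l = walk-++ a⇝k (step (walk-target∈ a⇝k) (clique k∈K l∈K k≢l) (walk-reverse b⇝l))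

  open import Data.List.Membership.Propositional using () renaming (_∈_ to _∈ₗ_; _∉_ to _∉ₗ_)
  open import Data.List.Membership.DecPropositional (_≟_ {n}) using () renaming (_∈?_ to _∈ₗ?_)

  data Path : Fin n → List (Fin n) → Fin n → Set where
    edge : ∀ {s t} → Adj G s t → Path s [] t
    cons : ∀ {s p ps t} → Adj G s p → p ∉ₗ ps → Path p ps t → Path s (p ∷ ps) t

  toSubset : List (Fin n) → Subset n
  toSubset ps = ⋃ (map ⁅_⁆ ps)

  ∈ₗ⇒∈toSubset : ∀ {a ps} → a ∈ₗ ps → a ∈ toSubset ps
  ∈ₗ⇒∈toSubset {a} (here refl) = x∈p∪q⁺ (inj₁ (x∈⁅x⁆ a))
  ∈ₗ⇒∈toSubset (there a∈ps) = x∈p∪q⁺ (inj₂ (∈ₗ⇒∈toSubset a∈ps))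

  ∈toSubset⇒∈ₗ : ∀ {a ps} → a ∈ toSubset ps → a ∈ₗ ps
  ∈toSubset⇒∈ₗ {ps = []} a∈ = ⊥-elim (∉⊥ a∈)
  ∈toSubset⇒∈ₗ {ps = p ∷ ps} a∈ with x∈p∪q⁻ ⁅ p ⁆ (toSubset ps) a∈
  ... | inj₁ a∈⁅p⁆ = here (x∈⁅y⁆⇒x≡y p a∈⁅p⁆)
  ... | inj₂ a∈ps = there (∈toSubset⇒∈ₗ a∈ps)

  path-suffix : ∀ {P : Fin n → Set} {s ps t a} → Path s ps t → a ∈ₗ ps → All P ps →
                ∃ λ qs → Path a qs t × a ∉ₗ qs × All P qs
  path-suffix (cons _ p∉ps path) (here refl) (_ ∷ Pps) = _ , path , p∉ps , Pps
  path-suffix (cons _ _ path) (there a∈ps) (_ ∷ Pps) = path-suffix path a∈ps Pps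

  -- The walk is shortened to a path at its first entry into K, cutting out cycles through its start.
  walk⇒path-into : ∀ {K U a z} → WalkIn G U a z → z ∈ K → a ∉ K →
                   ∃ λ ps → ∃ λ q → q ∈ K × q ∈ U × All (_∉ K) ps × a ∉ₗ ps × Path a ps q
  walk⇒path-into (here z∈U) z∈K a∉K = ⊥-elim (a∉K z∈K)
  walk⇒path-into {K} (step {y = b} _ e walk) z∈K a∉K with b ∈? K
  ... | yes b∈K = [] , b , b∈K , walk-source∈ walk , [] , (λ ()) , edge e
  ... | no b∉K with walk⇒path-into walk z∈K b∉K
  ... | ps , q , q∈K , q∈U , ps∉K , b∉ps , path with _ ∈ₗ? ps
  ...   | yes a∈ps = let qs , path′ , a∉qs , qs∉K = path-suffix path a∈ps ps∉K
                     in qs , q , q∈K , q∈U , qs∉K , a∉qs , path′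
  ...   | no a∉ps = b ∷ ps , q , q∈K , q∈U , b∉K ∷ ps∉K ,
                    (λ { (here refl) → irrefl G e ; (there a∈ps) → a∉ps a∈ps }) , cons e b∉ps path

  path⇒walk : ∀ {W s ps t} → Path s ps t → s ∈ W → All (_∈ W) ps → t ∈ W → WalkIn G W s t
  path⇒walk (edge e) s∈W [] t∈W = step s∈W e (here t∈W)
  path⇒walk (cons e _ path) s∈W (p∈W ∷ ps⊆W) t∈W = step s∈W e (path⇒walk path p∈W ps⊆W t∈W)

  path-interior⇒walk : ∀ {W s ps t a} → Path s ps t → All (_∈ W) ps → t ∈ W → a ∈ₗ ps →
                       WalkIn G W a t
  path-interior⇒walk (cons _ _ path) (p∈W ∷ ps⊆W) t∈W (here refl) = path⇒walk path p∈W ps⊆W t∈W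
  path-interior⇒walk (cons _ _ path) (_ ∷ ps⊆W) t∈W (there a∈ps) = path-interior⇒walk path ps⊆W t∈W a∈ps

  All∈-minus : ∀ {U : Subset n} {c ps} → All (_∈ U) ps → c ∉ₗ ps → All (_∈ U - c) ps
  All∈-minus [] _ = []
  All∈-minus (p∈U ∷ ps⊆U) c∉ = x∈p∧x≢y⇒x∈p-y p∈U (λ { refl → c∉ (here refl) }) ∷ All∈-minus ps⊆U (c∉ ∘ there)

  interior⇝end : ∀ {U : Subset n} {s ps t a c} → Path s ps t → s ∉ₗ ps → t ∉ₗ ps → s ≢ t →
                 All (_∈ U) ps → s ∈ U → t ∈ U → a ∈ₗ ps → c ≢ a →
                 WalkIn G (U - c) a t ⊎ WalkIn G (U - c) a s
  interior⇝end-≢source : ∀ {U : Subset n} {s ps t a c} → Path s ps t → s ∉ₗ ps → t ∉ₗ ps → s ≢ t →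
                         All (_∈ U) ps → s ∈ U → t ∈ U → a ∈ₗ ps → c ≢ a → c ≢ s →
                         WalkIn G (U - c) a t ⊎ WalkIn G (U - c) a s
  interior⇝end {c = c} path s∉ t∉ s≢t ps⊆U s∈U t∈U a∈ps c≢a with c ∈ₗ? _ | c ≟ _
  ... | no c∉ps | no c≢t =
    inj₁ (path-interior⇒walk path (All∈-minus ps⊆U c∉ps) (x∈p∧x≢y⇒x∈p-y t∈U (c≢t ∘ sym)) a∈ps)
  ... | yes c∈ps | _ = interior⇝end-≢source path s∉ t∉ s≢t ps⊆U s∈U t∈U a∈ps c≢a λ { refl → s∉ c∈ps }
  ... | no _ | yes refl = interior⇝end-≢source path s∉ t∉ s≢t ps⊆U s∈U t∈U a∈ps c≢a λ { refl → s≢t refl }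
  interior⇝end-≢source (cons e _ _) _ _ _ (p∈U ∷ _) s∈U _ (here refl) c≢a c≢s =
    inj₂ (step (x∈p∧x≢y⇒x∈p-y p∈U (c≢a ∘ sym)) (Adj-sym G e) (here (x∈p∧x≢y⇒x∈p-y s∈U (c≢s ∘ sym))))
  interior⇝end-≢source (cons e p∉ps path) _ t∉ _ (p∈U ∷ ps⊆U) s∈U t∈U (there a∈ps) c≢a c≢s
    with interior⇝end path p∉ps (t∉ ∘ there) (λ { refl → t∉ (here refl) }) ps⊆U p∈U t∈U a∈ps c≢a
  ... | inj₁ a⇝t = inj₁ a⇝t
  ... | inj₂ a⇝p = inj₂ (walk-snoc a⇝p (Adj-sym G e) (x∈p∧x≢y⇒x∈p-y s∈U (c≢s ∘ sym)))

  clique∪path-nonseparable : ∀ {K x ps q} → IsClique G K → x ∈ K → q ∈ K → x ≢ q →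
                             All (_∉ K) ps → Path x ps q → Nonseparable G (K ∪ toSubset ps)
  clique∪path-nonseparable {K} {x} {ps} {q} clique x∈K q∈K x≢q ps∉K path =
    connected-via-clique clique toK ,
    λ c (_ , disconnected) → disconnected (connected-via-clique clique (toK-avoiding c))
    where
    B : Subset n
    B = K ∪ toSubset ps
    ps⊆B : All (_∈ B) ps
    ps⊆B = tabulate (x∈p∪q⁺ ∘ inj₂ ∘ ∈ₗ⇒∈toSubset)
    ∉ps : ∀ {k} → k ∈ K → k ∉ₗ ps
    ∉ps k∈K k∈ps = lookup ps∉K k∈ps k∈K
    toK : ∀ {a} → a ∈ B → ∃ λ k → k ∈ K × WalkIn G B a k
    toK {a} a∈B with x∈p∪q⁻ K (toSubset ps) a∈B
    ... | inj₁ a∈K = a , a∈K , here a∈B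
    ... | inj₂ a∈ps = q , q∈K , path-interior⇒walk path ps⊆B (x∈p∪q⁺ (inj₁ q∈K)) (∈toSubset⇒∈ₗ a∈ps)
    toK-avoiding : ∀ c {a} → a ∈ B - c → ∃ λ k → k ∈ K × WalkIn G (B - c) a k
    toK-avoiding c {a} a∈B-c with x∈p-y⁻ B a∈B-c
    ... | a∈B , a≢c with x∈p∪q⁻ K (toSubset ps) a∈B
    ... | inj₁ a∈K = a , a∈K , here a∈B-c
    ... | inj₂ a∈ps with interior⇝end path (∉ps x∈K) (∉ps q∈K) x≢q ps⊆B
                           (x∈p∪q⁺ (inj₁ x∈K)) (x∈p∪q⁺ (inj₁ q∈K)) (∈toSubset⇒∈ₗ a∈ps) (a≢c ∘ sym)
    ... | inj₁ a⇝q = q , q∈K , a⇝q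
    ... | inj₂ a⇝x = x , x∈K , a⇝x

  -- If G − x were connected, a path from y back to K avoiding x would enlarge the block K.
  outside-neighbour⇒cutVertex : ∀ {K x y z} → IsClique G K → IsBlock G K → x ∈ K → z ∈ K → z ≢ x →
                                Adj G x y → y ∉ K → IsCutVertex G x
  outside-neighbour⇒cutVertex {K} {x} {y} {z} clique (_ , maximal) x∈K z∈K z≢x x~y y∉K = ∈⊤ , G-x-disconnected
    where
    G-x-disconnected : ¬ Connected G (⊤ - x)
    G-x-disconnected connected
      with walk⇒path-into (connected (x∈p∧x≢y⇒x∈p-y ∈⊤ λ { refl → y∉K x∈K }) (x∈p∧x≢y⇒x∈p-y ∈⊤ z≢x)) z∈K y∉K
    ... | ps , q , q∈K , q∈⊤-x , ps∉K , y∉ps , y⇝q =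
      y∉K (maximal (K ∪ toSubset (y ∷ ps)) (p⊆p∪q _)
             (clique∪path-nonseparable clique x∈K q∈K (λ { refl → proj₂ (x∈p-y⁻ ⊤ q∈⊤-x) refl })
                                       (y∉K ∷ ps∉K) (cons x~y y∉ps y⇝q))
             (x∈p∪q⁺ (inj₂ (∈ₗ⇒∈toSubset {ps = y ∷ ps} (here refl)))))

module _ {n : ℕ} (G : SimpleGraph n) where

  Reach⇒⊇ : ∀ {U S B} → Reach G U S B → S ⊆ B
  Reach⇒⊇ start x∈S = x∈S
  Reach⇒⊇ (force reach _) x∈S = x∈p∪⁅y⁆⁺ (inj₁ (Reach⇒⊇ reach x∈S))

  ZeroForcingNumber-unique : ∀ {U k l} → ZeroForcingNumber G U k → ZeroForcingNumber G U l → k ≡ l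
  ZeroForcingNumber-unique ((S , S-zfs , refl) , S-min) ((S′ , S′-zfs , refl) , S′-min) =
    ≤-antisym (S-min S′ S′-zfs) (S′-min S S-zfs)

  Twins : Subset n → Subset n → Set
  Twins U T = ∀ {t t′ u} → t ∈ T → t′ ∈ T → u ∈ U → u ≢ t′ → Adj G u t → Adj G u t′

  -- No vertex can force one of two white twins, since it would see the other one as well.
  IsZFS-misses-≤1-twin : ∀ {U S T} → IsZFS G U S → T ⊆ U → Twins U T →
                         ∀ {a b} → a ∈ T → b ∈ T → a ∉ S → b ∉ S → a ≡ b
  IsZFS-misses-≤1-twin {U} {S} {T} (_ , B , reach , U⊆B) T⊆U twins {a} {b} a∈T b∈T a∉S b∉S with a ≟ b
  ... | yes a≡b = a≡b
  ... | no a≢b = ⊥-elim (proj₁ (stay-white reach) (U⊆B (T⊆U a∈T)))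
    where
    not-forced : ∀ {B u w a b} → a ∈ T → b ∈ T → a ≢ b → a ∉ B → b ∉ B → Forces G U B u w → w ≢ a
    not-forced a∈T b∈T a≢b a∉B b∉B (u∈U , u∈B , _ , _ , u~w , only-w) refl =
      a≢b (sym (only-w _ (T⊆U b∈T) (twins a∈T b∈T u∈U (λ { refl → b∉B u∈B }) u~w) b∉B))
    stay-white : ∀ {B} → Reach G U S B → a ∉ B × b ∉ B
    stay-white start = a∉S , b∉S
    stay-white (force {Blue = B} reach f) with stay-white reach
    ... | a∉B , b∉B =
      [ a∉B , not-forced a∈T b∈T a≢b a∉B b∉B f ∘ sym ]′ ∘ x∈p∪⁅y⁆⁻ B ,
      [ b∉B , not-forced b∈T a∈T (a≢b ∘ sym) b∉B a∉B f ∘ sym ]′ ∘ x∈p∪⁅y⁆⁻ B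

  IsZFS⇒∣twins∣≤1+∣S∩twins∣ : ∀ {U S T} → IsZFS G U S → T ⊆ U → Twins U T → ∣ T ∣ ≤ suc ∣ S ∩ T ∣
  IsZFS⇒∣twins∣≤1+∣S∩twins∣ {S = S} {T} zfs T⊆U twins =
    ∣p∣≤1+∣q∣ T (S ∩ T) λ a∈T b∈T a∉S∩T b∉S∩T →
      IsZFS-misses-≤1-twin zfs T⊆U twins a∈T b∈T (a∉S∩T ∘ x∈p∩q⁺ ∘ (_, a∈T)) (b∉S∩T ∘ x∈p∩q⁺ ∘ (_, b∈T))

  ZeroForcingNumber-clique : ∀ {K u w} → IsClique G K → u ∈ K → w ∈ K → u ≢ w →
                             ZeroForcingNumber G K ∣ K - w ∣
  ZeroForcingNumber-clique {K} {u} {w} clique u∈K w∈K u≢w = (K - w , K-w-zfs , refl) , minimal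
    where
    u∈K-w : u ∈ K - w
    u∈K-w = x∈p∧x≢y⇒x∈p-y u∈K u≢w
    only-w : ∀ y → y ∈ K → Adj G u y → y ∉ K - w → y ≡ w
    only-w y y∈K _ y∉K-w with y ≟ w
    ... | yes y≡w = y≡w
    ... | no y≢w = ⊥-elim (y∉K-w (x∈p∧x≢y⇒x∈p-y y∈K y≢w))
    u-forces-w : Forces G K (K - w) u w
    u-forces-w = u∈K , u∈K-w , w∈K , (λ w∈K-w → proj₂ (x∈p-y⁻ K w∈K-w) refl) , clique u∈K w∈K u≢w , only-w
    K-w-zfs : IsZFS G K (K - w)
    K-w-zfs = proj₁ ∘ x∈p-y⁻ K , (K - w) ∪ ⁅ w ⁆ , force start u-forces-w , p⊆p-x∪⁅x⁆ K w
    minimal : ∀ S → IsZFS G K S → ∣ K - w ∣ ≤ ∣ S ∣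
    minimal S zfs = s≤s⁻¹ (begin
      suc ∣ K - w ∣  ≡⟨ sym (∣p∣≡1+∣p-x∣ K w∈K) ⟩
      ∣ K ∣          ≤⟨ IsZFS⇒∣twins∣≤1+∣S∩twins∣ zfs id (λ _ t′∈K u∈K u≢t′ _ → clique u∈K t′∈K u≢t′) ⟩
      suc ∣ S ∩ K ∣  ≤⟨ s≤s (∣p∩q∣≤∣p∣ S K) ⟩
      suc ∣ S ∣      ∎)
      where open ≤-Reasoning

  -- Forcing in G is replayed inside G[A]; the only forces it cannot replay are those from outside A.
  Reach-restrict : ∀ {A T T₁ : Subset n} → (∀ {y} → y ∈ T → y ∈ A → y ∈ T₁) →
                   (∀ {B u w} → Reach G ⊤ T B → Forces G ⊤ B u w → u ∉ A → w ∈ A → w ∈ T₁) →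
                   ∀ {B} → Reach G ⊤ T B → ∃ λ B₁ → Reach G A T₁ B₁ × (∀ {y} → y ∈ B → y ∈ A → y ∈ B₁)
  Reach-restrict T∩A⊆T₁ _ start = _ , start , T∩A⊆T₁
  Reach-restrict {A} {T₁ = T₁} T∩A⊆T₁ outside-forces (force {Blue = B} {u} {w} reach u-forces-w)
    with Reach-restrict T∩A⊆T₁ outside-forces reach
  ... | B₁ , reach₁ , B∩A⊆B₁ with w ∈? A | w ∈? B₁ | u ∈? A
  ... | no w∉A | _ | _ = B₁ , reach₁ , λ y∈B∪w y∈A →
          [ (λ y∈B → B∩A⊆B₁ y∈B y∈A) , (λ { refl → ⊥-elim (w∉A y∈A) }) ]′ (x∈p∪⁅y⁆⁻ B y∈B∪w)
  ... | yes _ | yes w∈B₁ | _ = B₁ , reach₁ , λ y∈B∪w y∈A →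
          [ (λ y∈B → B∩A⊆B₁ y∈B y∈A) , (λ { refl → w∈B₁ }) ]′ (x∈p∪⁅y⁆⁻ B y∈B∪w)
  ... | yes w∈A | no w∉B₁ | no u∉A =
          ⊥-elim (w∉B₁ (Reach⇒⊇ reach₁ (outside-forces reach u-forces-w u∉A w∈A)))
  ... | yes w∈A | no w∉B₁ | yes u∈A = B₁ ∪ ⁅ w ⁆ , force reach₁ u-forces-w-in-A , λ y∈B∪w y∈A →
          x∈p∪⁅y⁆⁺ ([ (λ y∈B → inj₁ (B∩A⊆B₁ y∈B y∈A)) , inj₂ ]′ (x∈p∪⁅y⁆⁻ B y∈B∪w))
    where
    u-forces-w-in-A : Forces G A B₁ u w
    u-forces-w-in-A =
      let _ , u∈B , _ , _ , u~w , only-w = u-forces-w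
      in u∈A , B∩A⊆B₁ u∈B u∈A , w∈A , w∉B₁ , u~w ,
         λ y y∈A u~y y∉B₁ → only-w y ∈⊤ u~y (λ y∈B → y∉B₁ (B∩A⊆B₁ y∈B y∈A))

  IsZFS-restrict : ∀ {A T T₁ : Subset n} → IsZFS G ⊤ T → T₁ ⊆ A → (∀ {y} → y ∈ T → y ∈ A → y ∈ T₁) →
                   (∀ {B u w} → Reach G ⊤ T B → Forces G ⊤ B u w → u ∉ A → w ∈ A → w ∈ T₁) →
                   IsZFS G A T₁
  IsZFS-restrict (_ , B , reach , ⊤⊆B) T₁⊆A T∩A⊆T₁ outside-forces
    with Reach-restrict T∩A⊆T₁ outside-forces reach
  ... | B₁ , reach₁ , B∩A⊆B₁ = T₁⊆A , B₁ , reach₁ , λ y∈A → B∩A⊆B₁ (⊤⊆B ∈⊤) y∈A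

-- K is a clique through which G meets the rest of the graph only at v, i.e. G = G[A] ⊕ᵥ K.
module CliqueAttachedAt {n : ℕ} (G : SimpleGraph n) {K : Subset n} {v : Fin n}
  (clique : IsClique G K) (v∈K : v ∈ K)
  (K-v-closed : ∀ {a b} → a ∈ K → a ≢ v → Adj G a b → b ∈ K) where

  K′ : Subset n
  K′ = K - v

  A : Subset n
  A = ⊤ ─ K′

  ∈A⇒∉K′ : ∀ {y} → y ∈ A → y ∉ K′
  ∈A⇒∉K′ y∈A = proj₂ (x∈p─q⁻ ⊤ K′ y∈A)

  ∉K′⇒∈A : ∀ {y} → y ∉ K′ → y ∈ A
  ∉K′⇒∈A = x∈p∧x∉q⇒x∈p─q ∈⊤

  ∈A⊎∈K′ : ∀ y → y ∈ A ⊎ y ∈ K′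
  ∈A⊎∈K′ y with y ∈? K′
  ... | yes y∈K′ = inj₂ y∈K′
  ... | no y∉K′ = inj₁ (∉K′⇒∈A y∉K′)

  v∈A : v ∈ A
  v∈A = ∉K′⇒∈A λ v∈K′ → proj₂ (x∈p-y⁻ K v∈K′) refl

  ∈A∩K⇒≡v : ∀ {y} → y ∈ A → y ∈ K → y ≡ v
  ∈A∩K⇒≡v {y} y∈A y∈K with y ≟ v
  ... | yes y≡v = y≡v
  ... | no y≢v = ⊥-elim (∈A⇒∉K′ y∈A (x∈p∧x≢y⇒x∈p-y y∈K y≢v))

  neighbour-of-K′⇒∈K : ∀ {u y} → y ∈ K′ → Adj G u y → u ∈ K
  neighbour-of-K′⇒∈K y∈K′ u~y = let y∈K , y≢v = x∈p-y⁻ K y∈K′ in K-v-closed y∈K y≢v (Adj-sym G u~y)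

  K′-twins : Twins G ⊤ K′
  K′-twins t∈K′ t′∈K′ _ u≢t′ u~t = clique (neighbour-of-K′⇒∈K t∈K′ u~t) (proj₁ (x∈p-y⁻ K t′∈K′)) u≢t′

  force-into-A⇒≡v : ∀ {B u w} → Forces G ⊤ B u w → u ∉ A → w ∈ A → w ≡ v
  force-into-A⇒≡v {u = u} (_ , _ , _ , _ , u~w , _) u∉A w∈A with u ∈? K′
  ... | no u∉K′ = ⊥-elim (u∉A (∉K′⇒∈A u∉K′))
  ... | yes u∈K′ = let u∈K , u≢v = x∈p-y⁻ K u∈K′ in ∈A∩K⇒≡v w∈A (K-v-closed u∈K u≢v u~w)

  module Extend {S₁ : Subset n} {w x : Fin n} (w∈K′ : w ∈ K′) (x∈K′-w : x ∈ K′ - w) where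

    S : Subset n
    S = S₁ ∪ (K′ - w)

    x∈K′ : x ∈ K′
    x∈K′ = proj₁ (x∈p-y⁻ K′ x∈K′-w)

    x≢w : x ≢ w
    x≢w = proj₂ (x∈p-y⁻ K′ x∈K′-w)

    x∈K : x ∈ K
    x∈K = proj₁ (x∈p-y⁻ K x∈K′)

    x≢v : x ≢ v
    x≢v = proj₂ (x∈p-y⁻ K x∈K′)

    w∈K : w ∈ K
    w∈K = proj₁ (x∈p-y⁻ K w∈K′)

    Saturated : Subset n → Set
    Saturated B = K′ - w ⊆ B × (v ∈ B → w ∈ B)

    saturate : ∀ {B} → Reach G ⊤ S B → K′ - w ⊆ B → ∃ λ B′ → Reach G ⊤ S B′ × B ⊆ B′ × Saturated B′
    saturate {B} reach K′-w⊆B with v ∈? B | w ∈? B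
    ... | no v∉B | _ = B , reach , id , K′-w⊆B , ⊥-elim ∘ v∉B
    ... | yes _ | yes w∈B = B , reach , id , K′-w⊆B , const w∈B
    ... | yes v∈B | no w∉B =
      B ∪ ⁅ w ⁆ , force reach x-forces-w ,
      x∈p∪⁅y⁆⁺ ∘ inj₁ , x∈p∪⁅y⁆⁺ ∘ inj₁ ∘ K′-w⊆B , const (x∈p∪⁅y⁆⁺ (inj₂ refl))
      where
      only-w : ∀ y → y ∈ ⊤ → Adj G x y → y ∉ B → y ≡ w
      only-w y _ x~y y∉B with y ≟ w | y ≟ v
      ... | yes y≡w | _ = y≡w
      ... | no _ | yes refl = ⊥-elim (y∉B v∈B)
      ... | no y≢w | no y≢v =
        ⊥-elim (y∉B (K′-w⊆B (x∈p∧x≢y⇒x∈p-y (x∈p∧x≢y⇒x∈p-y (K-v-closed x∈K x≢v x~y) y≢v) y≢w)))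
      x-forces-w : Forces G ⊤ B x w
      x-forces-w = ∈⊤ , K′-w⊆B x∈K′-w , ∈⊤ , w∉B , clique x∈K w∈K x≢w , only-w

    -- Every force of G[A] from S₁ is replayed in G: a vertex of A sees K′ only if it is v, and
    -- once v is blue so are all of K′.
    lift : ∀ {B} → Reach G A S₁ B → ∃ λ B′ → Reach G ⊤ S B′ × B ⊆ B′ × Saturated B′
    lift start with saturate start (x∈p∪q⁺ ∘ inj₂)
    ... | B′ , reach′ , S⊆B′ , saturated = B′ , reach′ , S⊆B′ ∘ x∈p∪q⁺ ∘ inj₁ , saturated
    lift (force {Blue = B} {u} {w₀} reach (u∈A , u∈B , _ , _ , u~w₀ , only-w₀)) with lift reach
    ... | B′ , reach′ , B⊆B′ , saturated@(K′-w⊆B′ , v⇒w) with w₀ ∈? B′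
    ...   | yes w₀∈B′ = B′ , reach′ , [ B⊆B′ , (λ { refl → w₀∈B′ }) ]′ ∘ x∈p∪⁅y⁆⁻ B , saturated
    ...   | no w₀∉B′ with saturate (force reach′ u-forces-w₀) (x∈p∪⁅y⁆⁺ ∘ inj₁ ∘ K′-w⊆B′)
      where
      only-w₀′ : ∀ y → y ∈ ⊤ → Adj G u y → y ∉ B′ → y ≡ w₀
      only-w₀′ y _ u~y y∉B′ with ∈A⊎∈K′ y
      ... | inj₁ y∈A = only-w₀ y y∈A u~y (y∉B′ ∘ B⊆B′)
      ... | inj₂ y∈K′ with y ≟ w
      ...   | yes refl =
        ⊥-elim (y∉B′ (v⇒w (subst (_∈ B′) (∈A∩K⇒≡v u∈A (neighbour-of-K′⇒∈K y∈K′ u~y)) (B⊆B′ u∈B))))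
      ...   | no y≢w = ⊥-elim (y∉B′ (K′-w⊆B′ (x∈p∧x≢y⇒x∈p-y y∈K′ y≢w)))
      u-forces-w₀ : Forces G ⊤ B′ u w₀
      u-forces-w₀ = ∈⊤ , B⊆B′ u∈B , ∈⊤ , w₀∉B′ , u~w₀ , only-w₀′
    ...     | B″ , reach″ , B′∪w₀⊆B″ , saturated″ =
      B″ , reach″ , B′∪w₀⊆B″ ∘ x∈p∪⁅y⁆⁺ ∘ map₁ B⊆B′ ∘ x∈p∪⁅y⁆⁻ B , saturated″

    IsZFS-extend : IsZFS G A S₁ → IsZFS G ⊤ S
    IsZFS-extend (_ , B , reach , A⊆B) with lift reach
    ... | B′ , reach′ , B⊆B′ , K′-w⊆B′ , v⇒w = const ∈⊤ , B′ , reach′ , covers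
      where
      covers : ⊤ ⊆ B′
      covers {y} _ with ∈A⊎∈K′ y
      ... | inj₁ y∈A = B⊆B′ (A⊆B y∈A)
      ... | inj₂ y∈K′ with y ≟ w
      ...   | yes refl = v⇒w (B⊆B′ (A⊆B v∈A))
      ...   | no y≢w = K′-w⊆B′ (x∈p∧x≢y⇒x∈p-y y∈K′ y≢w)

    ∣S∣≡∣S₁∣+∣K′-w∣ : IsZFS G A S₁ → ∣ S ∣ ≡ ∣ S₁ ∣ + ∣ K′ - w ∣
    ∣S∣≡∣S₁∣+∣K′-w∣ (S₁⊆A , _) = disjoint⇒∣p∪q∣≡∣p∣+∣q∣ S₁ (K′ - w) λ y∈S₁ y∈K′-w →
      ∈A⇒∉K′ (S₁⊆A y∈S₁) (proj₁ (x∈p-y⁻ K′ y∈K′-w))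

  IsZFS-restrict-∪v : ∀ {T} → IsZFS G ⊤ T → IsZFS G A ((T ∩ A) ∪ ⁅ v ⁆)
  IsZFS-restrict-∪v {T} zfs =
    IsZFS-restrict G zfs
      ([ proj₂ ∘ x∈p∩q⁻ T A , (λ { refl → v∈A }) ]′ ∘ x∈p∪⁅y⁆⁻ (T ∩ A))
      (λ y∈T y∈A → x∈p∪q⁺ (inj₁ (x∈p∩q⁺ (y∈T , y∈A))))
      (λ _ u-forces-w u∉A w∈A → x∈p∪⁅y⁆⁺ (inj₂ (force-into-A⇒≡v u-forces-w u∉A w∈A)))

  module Missing {T : Subset n} {w′ : Fin n} (w′∈K′ : w′ ∈ K′) (w′∉T : w′ ∉ T) where

    w′∈K : w′ ∈ K
    w′∈K = proj₁ (x∈p-y⁻ K w′∈K′)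

    w′≢v : w′ ≢ v
    w′≢v = proj₂ (x∈p-y⁻ K w′∈K′)

    -- The vertex forcing w′ lies in K, so it sees v as well.
    w′-blue⇒v-blue : ∀ {B} → Reach G ⊤ T B → w′ ∈ B → v ∈ B
    w′-blue⇒v-blue start w′∈T = ⊥-elim (w′∉T w′∈T)
    w′-blue⇒v-blue (force {Blue = B} {u} reach (_ , u∈B , _ , _ , u~w₀ , only-w₀)) w′∈B∪w₀
      with x∈p∪⁅y⁆⁻ B w′∈B∪w₀
    ... | inj₁ w′∈B = x∈p∪⁅y⁆⁺ (inj₁ (w′-blue⇒v-blue reach w′∈B))
    ... | inj₂ refl with u ≟ v | v ∈? B
    ...   | yes refl | _ = x∈p∪⁅y⁆⁺ (inj₁ u∈B)
    ...   | no _ | yes v∈B = x∈p∪⁅y⁆⁺ (inj₁ v∈B)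
    ...   | no u≢v | no v∉B =
      ⊥-elim (w′≢v (sym (only-w₀ v ∈⊤ (clique (neighbour-of-K′⇒∈K w′∈K′ u~w₀) v∈K u≢v) v∉B)))

    K′-forcer-into-A-sees-w′-blue : ∀ {B u w} → Forces G ⊤ B u w → u ∉ A → w ∈ A → w′ ∈ B
    K′-forcer-into-A-sees-w′-blue {B} {u} (_ , u∈B , _ , _ , _ , only-w) u∉A w∈A with ∈A⊎∈K′ u
    ... | inj₁ u∈A = ⊥-elim (u∉A u∈A)
    ... | inj₂ u∈K′ with u ≟ w′ | w′ ∈? B
    ...   | yes refl | _ = u∈B
    ...   | no _ | yes w′∈B = w′∈B
    ...   | no u≢w′ | no w′∉B with only-w w′ ∈⊤ (clique (proj₁ (x∈p-y⁻ K u∈K′)) w′∈K u≢w′) w′∉B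
    ...     | refl = ⊥-elim (∈A⇒∉K′ w∈A w′∈K′)

    IsZFS-restrict-missing : IsZFS G ⊤ T → IsZFS G A (T ∩ A)
    IsZFS-restrict-missing zfs =
      IsZFS-restrict G zfs (proj₂ ∘ x∈p∩q⁻ T A) (λ y∈T y∈A → x∈p∩q⁺ (y∈T , y∈A)) outside-forces
      where
      outside-forces : ∀ {B u w} → Reach G ⊤ T B → Forces G ⊤ B u w → u ∉ A → w ∈ A → w ∈ T ∩ A
      outside-forces reach u-forces-w@(_ , _ , _ , w∉B , _ , _) u∉A w∈A
        with force-into-A⇒≡v u-forces-w u∉A w∈A
      ... | refl = ⊥-elim (w∉B (w′-blue⇒v-blue reach (K′-forcer-into-A-sees-w′-blue u-forces-w u∉A w∈A)))

  lower-bound : ∀ {k₁ T} → (∀ S → IsZFS G A S → k₁ ≤ ∣ S ∣) → IsZFS G ⊤ T → k₁ + ∣ K′ ∣ ≤ suc ∣ T ∣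
  lower-bound {k₁} {T} minimal zfs with ⊆⊎∃∉ K′ T
  ... | inj₁ K′⊆T = begin
    k₁ + ∣ K′ ∣                   ≤⟨ +-mono-≤ (minimal _ (IsZFS-restrict-∪v zfs))
                                              (p⊆q⇒∣p∣≤∣q∣ (λ y∈K′ → x∈p∩q⁺ (K′⊆T y∈K′ , y∈K′))) ⟩
    ∣ (T ∩ A) ∪ ⁅ v ⁆ ∣ + ∣ T ∩ K′ ∣  ≤⟨ +-mono-≤ (∣p∪⁅x⁆∣≤1+∣p∣ (T ∩ A) v) ≤-refl ⟩
    suc (∣ T ∩ A ∣ + ∣ T ∩ K′ ∣)    ≤⟨ s≤s (disjoint⇒∣p∩q∣+∣p∩r∣≤∣p∣ T A K′ ∈A⇒∉K′) ⟩
    suc ∣ T ∣                      ∎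
    where open ≤-Reasoning
  ... | inj₂ (w′ , w′∈K′ , w′∉T) = begin
    k₁ + ∣ K′ ∣                   ≤⟨ +-mono-≤ (minimal _ (Missing.IsZFS-restrict-missing w′∈K′ w′∉T zfs))
                                              (IsZFS⇒∣twins∣≤1+∣S∩twins∣ G zfs (const ∈⊤) K′-twins) ⟩
    ∣ T ∩ A ∣ + suc ∣ T ∩ K′ ∣      ≡⟨ +-suc ∣ T ∩ A ∣ ∣ T ∩ K′ ∣ ⟩
    suc (∣ T ∩ A ∣ + ∣ T ∩ K′ ∣)    ≤⟨ s≤s (disjoint⇒∣p∩q∣+∣p∩r∣≤∣p∣ T A K′ ∈A⇒∉K′) ⟩
    suc ∣ T ∣                      ∎
    where open ≤-Reasoning

  ZeroForcingNumber-attach : ∀ {w x k₁} → w ∈ K′ → x ∈ K′ - w → ZeroForcingNumber G A k₁ →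
                             ZeroForcingNumber G ⊤ (k₁ + ∣ K′ ∣ ∸ 1)
  ZeroForcingNumber-attach {w} {x} {k₁} w∈K′ x∈K′-w ((S₁ , zfs₁ , refl) , minimal) =
    subst (ZeroForcingNumber G ⊤) k₁+∣K′-w∣≡k₁+∣K′∣∸1
      ((S , IsZFS-extend zfs₁ , ∣S∣≡∣S₁∣+∣K′-w∣ zfs₁) ,
       λ T zfs → s≤s⁻¹ (subst (_≤ suc ∣ T ∣) k₁+∣K′∣≡1+k₁+∣K′-w∣ (lower-bound minimal zfs)))
    where
    open Extend w∈K′ x∈K′-w
    k₁+∣K′∣≡1+k₁+∣K′-w∣ : k₁ + ∣ K′ ∣ ≡ suc (k₁ + ∣ K′ - w ∣)
    k₁+∣K′∣≡1+k₁+∣K′-w∣ = trans (cong (k₁ +_) (∣p∣≡1+∣p-x∣ K′ w∈K′)) (+-suc k₁ ∣ K′ - w ∣)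
    k₁+∣K′-w∣≡k₁+∣K′∣∸1 : k₁ + ∣ K′ - w ∣ ≡ k₁ + ∣ K′ ∣ ∸ 1
    k₁+∣K′-w∣≡k₁+∣K′∣∸1 = cong (_∸ 1) (sym k₁+∣K′∣≡1+k₁+∣K′-w∣)

mainTheorem4 : ∀ {n} (G : SimpleGraph n) →
    IsCliqueTree G →
    (∀ B → IsBlock G B → 3 ≤ ∣ B ∣) →
    (v : Fin n) → IsCutVertex G v →
    (K : Subset n) → IsPendantBlock G K → v ∈ K →
    ∀ k₁ k₂ →
    ZeroForcingNumber G (⊤ ─ (K - v)) k₁ →
    ZeroForcingNumber G K k₂ →
    ZeroForcingNumber G ⊤ (k₁ + k₂ ∸ 1)
mainTheorem4 G (_ , blocks-complete) big v v-cut K (K-block , _ , _ , cut-unique) v∈K k₁ k₂ Z₁ Z₂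
  with 3≤∣p∣⇒two-others K v∈K (big K K-block)
... | w , w∈K-v , x , x∈K-v-w =
  subst (λ k → ZeroForcingNumber G ⊤ (k₁ + k ∸ 1)) (sym k₂≡∣K-v∣) (ZeroForcingNumber-attach w∈K-v x∈K-v-w Z₁)
  where
  clique : IsClique G K
  clique = blocks-complete K K-block

  -- v is the only cut vertex of G in K.
  K-v-closed : ∀ {a b} → a ∈ K → a ≢ v → Adj G a b → b ∈ K
  K-v-closed {a} {b} a∈K a≢v a~b with b ∈? K
  ... | yes b∈K = b∈K
  ... | no b∉K = ⊥-elim (a≢v (trans (cut-unique a a∈K a-cut) (sym (cut-unique v v∈K v-cut))))
    where
    a-cut : IsCutVertex G a
    a-cut = outside-neighbour⇒cutVertex G clique K-block a∈K v∈K (a≢v ∘ sym) a~b b∉K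

  open CliqueAttachedAt G clique v∈K K-v-closed

  k₂≡∣K-v∣ : k₂ ≡ ∣ K - v ∣
  k₂≡∣K-v∣ = let w∈K , w≢v = x∈p-y⁻ K w∈K-v in
             ZeroForcingNumber-unique G Z₂ (ZeroForcingNumber-clique G clique w∈K v∈K w≢v)
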